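{- Let $\mathbb{L}$ be a (not necessarily commutative) ring with unity. Let $V$ be a finite set and $n=|V|$. For each $s\in V$, let $x_s\in\mathbb{L}$. Let $X,Y\in\mathbb{L}$ be such that $X+Y$ lies in the center of $\mathbb{L}$. Then \[ \sum_{S\subseteq V}X\Big(X+\sum_{s\in S}x_s\Big)^{|S|-1}\Big(Y-\sum_{s\in S}x_s\Big)^{n-|S|}=(X+Y)^n, \] where for $S=\varnothing$ the product $X\big(X+\sum_{s\in S}x_s\big)^{|S|-1}$ is interpreted as $1$. -}

module Defs where

open import Level using (Level)
open import Algebra.Bundles using (Ring)
open import Data.Nat using (ℕ; zero; suc; _∸_)
open import Data.Bool using (Bool; true; false; if_then_else_)
open import Data.Fin using (Fin)
open import Data.Fin.Subset using (Subset; ∣_∣)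
open import Data.Vec using (Vec; []; _∷_)
open import Data.List using (List; []; _∷_; map; _++_; foldr)

allSubsets : (n : ℕ) → List (Subset n)
allSubsets zero = [] ∷ []
allSubsets (suc n) = map (false ∷_) (allSubsets n) ++ map (true ∷_) (allSubsets n)

module RingDefs {c ℓ : Level} (R : Ring c ℓ) where
  open Ring R

  pow : Carrier → ℕ → Carrier
  pow x zero = 1#
  pow x (suc k) = x * pow x k

  sumL : List Carrier → Carrier
  sumL = foldr _+_ 0#

  sumOver : ∀ {n} → Subset n → (Fin n → Carrier) → Carrier
  sumOver [] x = 0#
  sumOver (b ∷ S) x = (if b then x Fin.zero else 0#) + sumOver S (λ i → x (Fin.suc i))

  headFactor : ∀ {n} → Carrier → Subset n → (Fin n → Carrier) → Carrier
  headFactor {n} X S x with ∣ S ∣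
  ... | zero = 1#
  ... | suc k = X * pow (X + sumOver S x) k

  term : (n : ℕ) → Carrier → Carrier → (Fin n → Carrier) → Subset n → Carrier
  term n X Y x S = headFactor X S x * pow (Y - sumOver S x) (n ∸ ∣ S ∣)

  Central : Carrier → Set (c Level.⊔ ℓ)
  Central z = ∀ w → z * w ≈ w * z

{-# OPTIONS --safe #-}
module Submission where

-- Put Z = X + Y and A_S = X + Σ_{s∈S} x_s, so that Y − Σ_{s∈S} x_s = Z − A_S, and for n variables let
-- Q_j(X) = Σ_T A_T^{j+|T|} (Z − A_T)^{n−|T|}. Splitting the subsets according to whether they contain
-- a fixed variable x₀ and using that Z is central, the sum of the theorem for n + 1 variables is
-- Z times the sum for the other n variables plus X·(Q₀(X + x₀) − Q₀(X)), and in the same way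
-- Q_j for n + 1 variables is Z·Q_j + (Q_{j+1}(X + x₀) − Q_{j+1}(X)) for n variables. Hence, by induction
-- on n, Q_j has degree ≤ j in the sense of finite differences: Q₀ is constant, the correction term
-- vanishes, and the identity follows by induction on n.

open import Defs
open import Level using (Level; _⊔_)
open import Algebra.Bundles using (Ring)
open import Data.Nat using (ℕ; zero; suc; _∸_; _≤_)
open import Data.Bool using (false; true)
open import Data.Fin using (Fin)
open import Data.Fin.Subset using (Subset; ∣_∣)
open import Data.Fin.Subset.Properties using (∣p∣≤n)
open import Data.List using ([]; _∷_; _++_; map)
open import Data.List.Properties using (map-++; map-∘)
open import Data.Vec using ([]; _∷_)
open import Data.Vec.Functional using (head; tail)
open import Function using (_∘_)
open import Relation.Binary.PropositionalEquality using (_≡_; cong; cong₂)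

import Data.Nat as ℕ
import Data.Nat.Properties as ℕₚ

module _ {c ℓ : Level} (R : Ring c ℓ) where
  open Ring R hiding (zero)
  open RingDefs R
  open import Algebra.Definitions _≈_ using (Congruent₁)
  open import Algebra.Properties.Ring R
  open import Algebra.Properties.CommutativeSemigroup +-commutativeSemigroup
    using (interchange; xy∙z≈x∙zy; xy∙z≈xz∙y)
  open import Relation.Binary.Reasoning.Setoid setoid

  [x-y]+[z-w]≈[x+z]-[y+w] : ∀ x y z w → (x - y) + (z - w) ≈ (x + z) - (y + w)
  [x-y]+[z-w]≈[x+z]-[y+w] x y z w = trans (interchange x (- y) z (- w)) (+-congˡ (-‿+-comm y w))

  [x+y]-[x+z]≈y-z : ∀ x y z → (x + y) - (x + z) ≈ y - z
  [x+y]-[x+z]≈y-z x y z = begin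
    (x + y) - (x + z)   ≈⟨ [x-y]+[z-w]≈[x+z]-[y+w] x x y z ⟨
    (x - x) + (y - z)   ≈⟨ +-congʳ (-‿inverseʳ x) ⟩
    0# + (y - z)        ≈⟨ +-identityˡ (y - z) ⟩
    y - z               ∎

  pow-congˡ : ∀ k → Congruent₁ (λ a → pow a k)
  pow-congˡ zero    a≈b = refl
  pow-congˡ (suc k) a≈b = *-cong a≈b (pow-congˡ k a≈b)

  pow-congʳ : ∀ a {k l} → k ≡ l → pow a k ≈ pow a l
  pow-congʳ a = reflexive ∘ cong (pow a)

  pow-*-comm : ∀ a k → pow a k * a ≈ a * pow a k
  pow-*-comm a zero    = trans (*-identityˡ a) (sym (*-identityʳ a))
  pow-*-comm a (suc k) = trans (*-assoc a (pow a k) a) (*-congˡ (pow-*-comm a k))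

  sumL-++ : ∀ xs ys → sumL (xs ++ ys) ≈ sumL xs + sumL ys
  sumL-++ []       ys = sym (+-identityˡ (sumL ys))
  sumL-++ (x ∷ xs) ys = trans (+-congˡ (sumL-++ xs ys)) (sym (+-assoc x (sumL xs) (sumL ys)))

  module _ {I : Set} where

    sumL-map-cong : ∀ {f g : I → Carrier} → (∀ i → f i ≈ g i) →
                    ∀ is → sumL (map f is) ≈ sumL (map g is)
    sumL-map-cong f≈g []       = refl
    sumL-map-cong f≈g (i ∷ is) = +-cong (f≈g i) (sumL-map-cong f≈g is)

    sumL-map-*ˡ : ∀ a (f : I → Carrier) is → sumL (map (λ i → a * f i) is) ≈ a * sumL (map f is)
    sumL-map-*ˡ a f []       = sym (zeroʳ a)
    sumL-map-*ˡ a f (i ∷ is) = trans (+-congˡ (sumL-map-*ˡ a f is)) (sym (distribˡ a (f i) _))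

    sumL-map-- : ∀ (f g : I → Carrier) is →
                 sumL (map (λ i → f i - g i) is) ≈ sumL (map f is) - sumL (map g is)
    sumL-map-- f g []       = sym (-‿inverseʳ 0#)
    sumL-map-- f g (i ∷ is) =
      trans (+-congˡ (sumL-map-- f g is)) ([x-y]+[z-w]≈[x+z]-[y+w] (f i) (g i) _ _)

  sumL-allSubsets-suc : ∀ {n} (f : Subset (suc n) → Carrier) →
    sumL (map f (allSubsets (suc n))) ≈
    sumL (map (f ∘ (false ∷_)) (allSubsets n)) + sumL (map (f ∘ (true ∷_)) (allSubsets n))
  sumL-allSubsets-suc {n} f = begin
    sumL (map f (map (false ∷_) Ss ++ map (true ∷_) Ss))
      ≡⟨ cong sumL (map-++ f (map (false ∷_) Ss) _) ⟩
    sumL (map f (map (false ∷_) Ss) ++ map f (map (true ∷_) Ss))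
      ≈⟨ sumL-++ (map f (map (false ∷_) Ss)) _ ⟩
    sumL (map f (map (false ∷_) Ss)) + sumL (map f (map (true ∷_) Ss))
      ≡⟨ cong₂ (λ xs ys → sumL xs + sumL ys) (map-∘ Ss) (map-∘ Ss) ⟨
    sumL (map (f ∘ (false ∷_)) Ss) + sumL (map (f ∘ (true ∷_)) Ss) ∎
    where
    Ss = allSubsets n

  Δ : Carrier → (Carrier → Carrier) → Carrier → Carrier
  Δ h f X = f (X + h) - f X

  Degree≤ : ℕ → (Carrier → Carrier) → Set (c ⊔ ℓ)
  Degree≤ zero    f = ∀ X X′ → f X ≈ f X′
  Degree≤ (suc j) f = ∀ h → Degree≤ j (Δ h f)

  Δ-cong : ∀ h {f} → Congruent₁ f → Congruent₁ (Δ h f)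
  Δ-cong h f-cong X≈X′ = +-cong (f-cong (+-congʳ X≈X′)) (-‿cong (f-cong X≈X′))

  Δ-X* : ∀ h g X → Δ h (λ X → X * g X) X ≈ X * Δ h g X + h * g (X + h)
  Δ-X* h g X = begin
    (X + h) * g (X + h) - X * g X               ≈⟨ +-congʳ (distribʳ (g (X + h)) X h) ⟩
    (X * g (X + h) + h * g (X + h)) - X * g X   ≈⟨ xy∙z≈xz∙y _ _ _ ⟩
    (X * g (X + h) - X * g X) + h * g (X + h)   ≈⟨ +-congʳ (x[y-z]≈xy-xz X _ _) ⟨
    X * Δ h g X + h * g (X + h)                 ∎

  Degree≤-cong : ∀ j {f g} → (∀ X → f X ≈ g X) → Degree≤ j f → Degree≤ j g
  Degree≤-cong zero    f≈g f-deg X X′ = trans (sym (f≈g X)) (trans (f-deg X X′) (f≈g X′))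
  Degree≤-cong (suc j) f≈g f-deg h =
    Degree≤-cong j (λ X → +-cong (f≈g (X + h)) (-‿cong (f≈g X))) (f-deg h)

  Degree≤-+ : ∀ j {f g} → Degree≤ j f → Degree≤ j g → Degree≤ j (λ X → f X + g X)
  Degree≤-+ zero    f-deg g-deg X X′ = +-cong (f-deg X X′) (g-deg X X′)
  Degree≤-+ (suc j) f-deg g-deg h =
    Degree≤-cong j (λ X → [x-y]+[z-w]≈[x+z]-[y+w] _ _ _ _) (Degree≤-+ j (f-deg h) (g-deg h))

  Degree≤-*ˡ : ∀ j a {f} → Degree≤ j f → Degree≤ j (λ X → a * f X)
  Degree≤-*ˡ zero    a f-deg X X′ = *-congˡ (f-deg X X′)
  Degree≤-*ˡ (suc j) a f-deg h = Degree≤-cong j (λ X → x[y-z]≈xy-xz a _ _) (Degree≤-*ˡ j a (f-deg h))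

  Degree≤-translate : ∀ j d {f} → Congruent₁ f → Degree≤ j f → Degree≤ j (λ X → f (X + d))
  Degree≤-translate zero    d f-cong f-deg X X′ = f-deg (X + d) (X′ + d)
  Degree≤-translate (suc j) d f-cong f-deg h =
    Degree≤-cong j (λ X → +-congʳ (f-cong (xy∙z≈xz∙y X d h)))
      (Degree≤-translate j d (Δ-cong h f-cong) (f-deg h))

  Degree≤-X* : ∀ j {g} → Congruent₁ g → Degree≤ j g → Degree≤ (suc j) (λ X → X * g X)
  Degree≤-X*Δ : ∀ j h {g} → Congruent₁ g → Degree≤ j g → Degree≤ j (λ X → X * Δ h g X)

  Degree≤-X* j {g} g-cong g-deg h =
    Degree≤-cong j (λ X → sym (Δ-X* h g X))
      (Degree≤-+ j (Degree≤-X*Δ j h g-cong g-deg) (Degree≤-*ˡ j h (Degree≤-translate j h g-cong g-deg)))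

  Degree≤-X*Δ zero    h {g} g-cong g-deg X X′ = trans (X*Δ≈0 X) (sym (X*Δ≈0 X′))
    where
    X*Δ≈0 : ∀ X → X * Δ h g X ≈ 0#
    X*Δ≈0 X = trans (*-congˡ (x≈y⇒x∙y⁻¹≈ε (g-deg (X + h) X))) (zeroʳ X)
  Degree≤-X*Δ (suc j) h g-cong g-deg = Degree≤-X* j (Δ-cong h g-cong) (g-deg h)

  Degree≤-pow : ∀ j → Degree≤ j (λ X → pow X j)
  Degree≤-pow zero    X X′ = refl
  Degree≤-pow (suc j) = Degree≤-X* j (pow-congˡ j) (Degree≤-pow j)

  module _ (Z : Carrier) where

    abelTerm : (n j m : ℕ) → Carrier → Carrier
    abelTerm n j m a = pow a (j ℕ.+ m) * pow (Z - a) (n ∸ m)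

    abelSum : (n j : ℕ) → (Fin n → Carrier) → Carrier → Carrier
    abelSum n j x X = sumL (map (λ T → abelTerm n j ∣ T ∣ (X + sumOver T x)) (allSubsets n))

    abelTerm-cong : ∀ n j m → Congruent₁ (abelTerm n j m)
    abelTerm-cong n j m a≈b = *-cong (pow-congˡ (j ℕ.+ m) a≈b) (pow-congˡ (n ∸ m) (+-congˡ (-‿cong a≈b)))

    module _ (Z-central : Central Z) where

      *-pow-sub-suc∸ : ∀ u a {m n} → m ≤ n →
        u * pow (Z - a) (suc n ∸ m) ≈ Z * (u * pow (Z - a) (n ∸ m)) - (u * a) * pow (Z - a) (n ∸ m)
      *-pow-sub-suc∸ u a {m} {n} m≤n = begin
        u * pow (Z - a) (suc n ∸ m)         ≈⟨ *-congˡ (pow-congʳ (Z - a) (ℕₚ.+-∸-assoc 1 m≤n)) ⟩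
        u * ((Z - a) * P)                   ≈⟨ *-congˡ ([y-z]x≈yx-zx P Z a) ⟩
        u * (Z * P - a * P)                 ≈⟨ x[y-z]≈xy-xz u (Z * P) (a * P) ⟩
        u * (Z * P) - u * (a * P)           ≈⟨ +-cong u[ZP]≈Z[uP] (-‿cong (*-assoc u a P)) ⟨
        Z * (u * P) - (u * a) * P           ∎
        where
        P = pow (Z - a) (n ∸ m)
        u[ZP]≈Z[uP] : Z * (u * P) ≈ u * (Z * P)
        u[ZP]≈Z[uP] = begin
          Z * (u * P)   ≈⟨ *-assoc Z u P ⟨
          (Z * u) * P   ≈⟨ *-congʳ (Z-central u) ⟩
          (u * Z) * P   ≈⟨ *-assoc u Z P ⟩
          u * (Z * P)   ∎

      abelTerm-suc : ∀ {n m} j a → m ≤ n →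
        abelTerm (suc n) j m a ≈ Z * abelTerm n j m a - abelTerm n (suc j) m a
      abelTerm-suc {m = m} j a m≤n =
        trans (*-pow-sub-suc∸ (pow a (j ℕ.+ m)) a m≤n)
              (+-congˡ (-‿cong (*-congʳ (pow-*-comm a (j ℕ.+ m)))))

      abelTerm-suc-suc : ∀ n j m a → abelTerm (suc n) j (suc m) a ≡ abelTerm n (suc j) m a
      abelTerm-suc-suc n j m a = cong (λ k → pow a k * pow (Z - a) (n ∸ m)) (ℕₚ.+-suc j m)

      abelSum-suc : ∀ n j x X →
        abelSum (suc n) j x X ≈ Z * abelSum n j (tail x) X + Δ (head x) (abelSum n (suc j) (tail x)) X
      abelSum-suc n j x X = begin
        abelSum (suc n) j x X
          ≈⟨ sumL-allSubsets-suc (λ T → abelTerm (suc n) j (∣ T ∣) (X + sumOver T x)) ⟩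
        sumL (map (λ T → abelTerm (suc n) j (∣ T ∣) (X + (0# + s T))) Ts) +
        sumL (map (λ T → abelTerm (suc n) j (suc (∣ T ∣)) (X + (head x + s T))) Ts)
          ≈⟨ +-cong (sumL-map-cong without-head Ts) (sumL-map-cong with-head Ts) ⟩
        sumL (map (λ T → Z * abelTerm n j (∣ T ∣) (X + s T) - abelTerm n (suc j) (∣ T ∣) (X + s T)) Ts) +
        abelSum n (suc j) (tail x) (X + head x)
          ≈⟨ +-congʳ (trans (sumL-map-- _ _ Ts) (+-congʳ (sumL-map-*ˡ Z _ Ts))) ⟩
        (Z * abelSum n j (tail x) X - abelSum n (suc j) (tail x) X) + abelSum n (suc j) (tail x) (X + head x)
          ≈⟨ xy∙z≈x∙zy _ _ _ ⟩
        Z * abelSum n j (tail x) X + Δ (head x) (abelSum n (suc j) (tail x)) X ∎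
        where
        Ts = allSubsets n
        s : Subset n → Carrier
        s T = sumOver T (tail x)
        without-head : ∀ T → abelTerm (suc n) j (∣ T ∣) (X + (0# + s T)) ≈
                             Z * abelTerm n j (∣ T ∣) (X + s T) - abelTerm n (suc j) (∣ T ∣) (X + s T)
        without-head T = trans (abelTerm-cong (suc n) j (∣ T ∣) (+-congˡ (+-identityˡ (s T))))
                               (abelTerm-suc j (X + s T) (∣p∣≤n T))
        with-head : ∀ T → abelTerm (suc n) j (suc (∣ T ∣)) (X + (head x + s T)) ≈
                          abelTerm n (suc j) (∣ T ∣) ((X + head x) + s T)
        with-head T = trans (reflexive (abelTerm-suc-suc n j (∣ T ∣) _))
                            (abelTerm-cong n (suc j) (∣ T ∣) (sym (+-assoc X (head x) (s T))))

      Degree≤-abelSum : ∀ n j x → Degree≤ j (abelSum n j x)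
      Degree≤-abelSum zero    j x = Degree≤-cong j (λ X → sym (abelSum-zero X)) (Degree≤-pow j)
        where
        abelSum-zero : ∀ X → abelSum zero j x X ≈ pow X j
        abelSum-zero X = begin
          pow (X + 0#) (j ℕ.+ 0) * 1# + 0#   ≈⟨ trans (+-identityʳ _) (*-identityʳ _) ⟩
          pow (X + 0#) (j ℕ.+ 0)             ≈⟨ trans (pow-congˡ (j ℕ.+ 0) (+-identityʳ X)) (pow-congʳ X (ℕₚ.+-identityʳ j)) ⟩
          pow X j                            ∎
      Degree≤-abelSum (suc n) j x =
        Degree≤-cong j (λ X → sym (abelSum-suc n j x X))
          (Degree≤-+ j (Degree≤-*ˡ j Z (Degree≤-abelSum n j (tail x)))
                       (Degree≤-abelSum n (suc j) (tail x) (head x)))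

  sumOver-empty : ∀ {n} (S : Subset n) x → ∣ S ∣ ≡ 0 → sumOver S x ≈ 0#
  sumOver-empty []          x _      = refl
  sumOver-empty (false ∷ S) x ∣S∣≡0 = trans (+-identityˡ _) (sumOver-empty S (tail x) ∣S∣≡0)

  headFactor-false : ∀ X {n} (T : Subset n) x → headFactor X (false ∷ T) x ≈ headFactor X T (tail x)
  headFactor-false X T x with ∣ T ∣
  ... | zero  = refl
  ... | suc k = *-congˡ (pow-congˡ k (+-congˡ (+-identityˡ (sumOver T (tail x)))))

  -- The convention headFactor ∅ = 1 is consistent here only because the empty sum vanishes.
  headFactor-*-+ : ∀ X {n} (S : Subset n) x →
    headFactor X S x * (X + sumOver S x) ≈ X * pow (X + sumOver S x) ∣ S ∣
  headFactor-*-+ X S x with ∣ S ∣ in ∣S∣≡k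
  ... | zero  = begin
    1# * (X + sumOver S x)   ≈⟨ *-identityˡ _ ⟩
    X + sumOver S x          ≈⟨ +-congˡ (sumOver-empty S x ∣S∣≡k) ⟩
    X + 0#                   ≈⟨ +-identityʳ X ⟩
    X                        ≈⟨ *-identityʳ X ⟨
    X * 1#                   ∎
  ... | suc k = trans (*-assoc X _ _) (*-congˡ (pow-*-comm _ k))

  term-true : ∀ X Y n x T →
    term (suc n) X Y x (true ∷ T) ≈ X * abelTerm (X + Y) n 0 ∣ T ∣ ((X + head x) + sumOver T (tail x))
  term-true X Y n x T = begin
    (X * pow (X + (head x + s)) m) * pow (Y - (head x + s)) (n ∸ m)
      ≈⟨ *-assoc X _ _ ⟩
    X * (pow (X + (head x + s)) m * pow (Y - (head x + s)) (n ∸ m))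
      ≈⟨ *-congˡ (*-cong (pow-congˡ m A≈A′) (pow-congˡ (n ∸ m) Y-[x₀+s]≈Z-A′)) ⟩
    X * abelTerm (X + Y) n 0 m A′ ∎
    where
    s = sumOver T (tail x)
    m = ∣ T ∣
    A′ = (X + head x) + s
    A≈A′ : X + (head x + s) ≈ A′
    A≈A′ = sym (+-assoc X (head x) s)
    Y-[x₀+s]≈Z-A′ : Y - (head x + s) ≈ (X + Y) - A′
    Y-[x₀+s]≈Z-A′ = trans (sym ([x+y]-[x+z]≈y-z X Y (head x + s))) (+-congˡ (-‿cong A≈A′))

  module _ {X Y : Carrier} (X+Y-central : Central (X + Y)) where

    term-false : ∀ n x T →
      term (suc n) X Y x (false ∷ T) ≈
      (X + Y) * term n X Y (tail x) T - X * abelTerm (X + Y) n 0 ∣ T ∣ (X + sumOver T (tail x))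
    term-false n x T = begin
      headFactor X (false ∷ T) x * pow (Y - (0# + s)) (suc n ∸ m)
        ≈⟨ *-cong (headFactor-false X T x) (pow-congˡ (suc n ∸ m) Y-[0+s]≈Z-A) ⟩
      H * pow (Z - A) (suc n ∸ m)
        ≈⟨ *-pow-sub-suc∸ Z X+Y-central H A (∣p∣≤n T) ⟩
      Z * (H * pow (Z - A) (n ∸ m)) - (H * A) * pow (Z - A) (n ∸ m)
        ≈⟨ +-cong (*-congˡ (*-congˡ (pow-congˡ (n ∸ m) ([x+y]-[x+z]≈y-z X Y s))))
                  (-‿cong (trans (*-congʳ (headFactor-*-+ X T (tail x))) (*-assoc X _ _))) ⟩
      Z * term n X Y (tail x) T - X * abelTerm Z n 0 m A ∎
      where
      Z = X + Y
      s = sumOver T (tail x)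
      m = ∣ T ∣
      A = X + s
      H = headFactor X T (tail x)
      Y-[0+s]≈Z-A : Y - (0# + s) ≈ Z - A
      Y-[0+s]≈Z-A = trans (+-congˡ (-‿cong (+-identityˡ s))) (sym ([x+y]-[x+z]≈y-z X Y s))

    abel-identity : ∀ n x → sumL (map (term n X Y x) (allSubsets n)) ≈ pow (X + Y) n
    abel-identity zero    x = trans (+-identityʳ _) (*-identityˡ 1#)
    abel-identity (suc n) x = begin
      sumL (map (term (suc n) X Y x) (allSubsets (suc n)))
        ≈⟨ sumL-allSubsets-suc (term (suc n) X Y x) ⟩
      sumL (map (term (suc n) X Y x ∘ (false ∷_)) Ts) + sumL (map (term (suc n) X Y x ∘ (true ∷_)) Ts)
        ≈⟨ +-cong (sumL-map-cong (term-false n x) Ts) (sumL-map-cong (term-true X Y n x) Ts) ⟩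
      sumL (map (λ T → Z * term n X Y x′ T - X * abelTerm Z n 0 (∣ T ∣) (X + sumOver T x′)) Ts) +
      sumL (map (λ T → X * abelTerm Z n 0 (∣ T ∣) ((X + head x) + sumOver T x′)) Ts)
        ≈⟨ +-cong (trans (sumL-map-- _ _ Ts) (+-cong (sumL-map-*ˡ Z _ Ts) (-‿cong (sumL-map-*ˡ X _ Ts))))
                  (sumL-map-*ˡ X _ Ts) ⟩
      (Z * F′ - X * Q X) + X * Q (X + head x)
        ≈⟨ +-congˡ (*-congˡ (Degree≤-abelSum Z X+Y-central n 0 x′ (X + head x) X)) ⟩
      (Z * F′ - X * Q X) + X * Q X
        ≈⟨ //-rightDividesˡ (X * Q X) (Z * F′) ⟩
      Z * F′
        ≈⟨ *-congˡ (abel-identity n x′) ⟩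
      Z * pow Z n ∎
      where
      Z = X + Y
      x′ = tail x
      Ts = allSubsets n
      F′ = sumL (map (term n X Y x′) Ts)
      Q = abelSum Z n 0 x′

theorem2p4 : ∀ {c ℓ} (R : Ring c ℓ) → (n : ℕ) (x : Fin n → Ring.Carrier R) (X Y : Ring.Carrier R) →
    RingDefs.Central R (Ring._+_ R X Y) →
    Ring._≈_ R (RingDefs.sumL R (map (RingDefs.term R n X Y x) (allSubsets n)))
      (RingDefs.pow R (Ring._+_ R X Y) n)
theorem2p4 R n x X Y X+Y-central = abel-identity R X+Y-central n x
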